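{- Let $G$ be a finite group and $g,h,c,u,v\in G$, with $w:=uv$, such that $\langle u,v\rangle\cong\mathrm{D}_8$ and $$G=(\langle g\rangle\times\langle w^2,v\rangle){:}\big((\langle h\rangle{:}\langle u\rangle)\times\langle c\rangle\big),$$ where $|g|,|h|,|c|$ are pairwise coprime, $\langle h\rangle$ is a Sylow $3$-subgroup of $G$, $\mathrm{C}_{\langle c\rangle}(g)\le\Phi(\langle c\rangle)$, $(w^2v,v,w^2)^h=(v,w^2,w^2v)$ and $h^u=h^{ -1}$. Then for $t\in\langle w^2,v\rangle$ we have $\langle th,u\rangle=\langle w^2,v\rangle{:}\langle h,u\rangle$ if and only if $t=v$ or $t=w^2$.
   Context: $A{:}B$ denotes a semidirect product with $A$ normal, and $\times$ an (internal) direct product; $a^b=b^{ -1}ab$; $\Phi$ is the Frattini subgroup and $\mathrm{C}$ the centralizer. -}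

module Defs where

open import Level using (0ℓ)
open import Algebra.Bundles using (Group)
open import Data.Nat as ℕ using (ℕ; zero; suc; _<_)
open import Data.Nat.Divisibility using (_∣_)
open import Data.Nat.DivMod using (_mod_)
open import Data.Fin using (Fin; toℕ)
open import Data.Bool using (Bool; true; false; if_then_else_; _xor_)
open import Data.List using (List; length)
open import Data.List.Relation.Unary.Any using (Any)
open import Data.List.Relation.Unary.All using (All)
open import Data.List.Relation.Unary.AllPairs using (AllPairs)
open import Data.Product using (Σ; ∃; ∃-syntax; _×_)
open import Data.Sum using (_⊎_)
open import Relation.Nullary using (¬_)
open import Relation.Binary.PropositionalEquality using (_≡_)

-- The element  d8 r s  stands for  ρ^r σ^s  (ρ rotation of order 4,
-- σ reflection, σ ρ σ = ρ⁻¹), so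
--   (ρ^r₁ σ^s₁)(ρ^r₂ σ^s₂) = ρ^(r₁ ± r₂) σ^(s₁ + s₂),  sign − iff s₁ = 1.

record D8 : Set where
  constructor d8
  field
    rot : Fin 4
    ref : Bool

_*D8_ : D8 → D8 → D8
d8 r₁ s₁ *D8 d8 r₂ s₂ =
  d8 ((toℕ r₁ ℕ.+ (if s₁ then 4 ℕ.∸ toℕ r₂ else toℕ r₂)) mod 4) (s₁ xor s₂)

module GroupDefs (G : Group 0ℓ 0ℓ) where
  open Group G public

  Subset : Set₁
  Subset = Carrier → Set

  _⊆_ : Subset → Subset → Set
  P ⊆ Q = ∀ x → P x → Q x

  _≐_ : Subset → Subset → Set
  P ≐ Q = (P ⊆ Q) × (Q ⊆ P)

  Univ : Subset
  Univ _ = Data.Unit.⊤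
    where import Data.Unit

  _·_ : Subset → Subset → Subset
  (P · Q) x = ∃[ a ] ∃[ b ] (P a × Q b × x ≈ a ∙ b)

  pow : Carrier → ℕ → Carrier
  pow x zero    = ε
  pow x (suc n) = x ∙ pow x n

  conj : Carrier → Carrier → Carrier
  conj a b = (b ⁻¹ ∙ a) ∙ b

  data ⟨_⟩ (S : Subset) : Subset where
    gen  : ∀ {x} → S x → ⟨ S ⟩ x
    one  : ⟨ S ⟩ ε
    mul  : ∀ {x y} → ⟨ S ⟩ x → ⟨ S ⟩ y → ⟨ S ⟩ (x ∙ y)
    inv  : ∀ {x} → ⟨ S ⟩ x → ⟨ S ⟩ (x ⁻¹)
    resp : ∀ {x y} → x ≈ y → ⟨ S ⟩ x → ⟨ S ⟩ y

  ⟨_⟩₁ : Carrier → Subset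
  ⟨ a ⟩₁ = ⟨ (λ x → x ≈ a) ⟩

  ⟨_,_⟩₂ : Carrier → Carrier → Subset
  ⟨ a , b ⟩₂ = ⟨ (λ x → (x ≈ a) ⊎ (x ≈ b)) ⟩

  IsSubgroup : Subset → Set
  IsSubgroup P = P ε
               × (∀ {x y} → P x → P y → P (x ∙ y))
               × (∀ {x} → P x → P (x ⁻¹))
               × (∀ {x y} → x ≈ y → P x → P y)

  IsFinite : Set
  IsFinite = ∃[ xs ] (∀ x → Any (x ≈_) xs)

  HasSize : Subset → ℕ → Set
  HasSize P n = ∃[ xs ] ( length xs ≡ n
                        × AllPairs (λ a b → ¬ (a ≈ b)) xs
                        × All P xs
                        × (∀ x → P x → Any (x ≈_) xs))

  HasOrder : Carrier → ℕ → Set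
  HasOrder x n = 0 < n × pow x n ≈ ε × (∀ m → 0 < m → m < n → ¬ (pow x m ≈ ε))

  IsSylow : ℕ → Subset → Set
  IsSylow p P = IsSubgroup P
              × ∃[ k ] ∃[ m ] ( HasSize P (p ℕ.^ k)
                              × HasSize Univ ((p ℕ.^ k) ℕ.* m)
                              × ¬ (p ∣ m))

  TrivInt : Subset → Subset → Set
  TrivInt P Q = ∀ x → P x → Q x → x ≈ ε

  -- internal direct product P × Q (of subgroups): elementwise commuting,
  -- trivial intersection; the product subgroup is  P · Q
  IsDirect : Subset → Subset → Set
  IsDirect P Q = (∀ a b → P a → Q b → a ∙ b ≈ b ∙ a) × TrivInt P Q

  -- internal semidirect product P : Q (of subgroups): Q normalises P,
  -- trivial intersection; the product subgroup is  P · Q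
  IsSemidirect : Subset → Subset → Set
  IsSemidirect P Q = (∀ a b → P a → Q b → P (conj a b)) × TrivInt P Q

  IsMaximalIn : Subset → Subset → Set₁
  IsMaximalIn M C = IsSubgroup M × M ⊆ C
                  × (∃[ x ] (C x × ¬ M x))
                  × (∀ L → IsSubgroup L → M ⊆ L → L ⊆ C → (L ⊆ M) ⊎ (C ⊆ L))

  Φ : Subset → Carrier → Set₁
  Φ C x = C x × (∀ M → IsMaximalIn M C → M x)

  IsoD8 : Subset → Set
  IsoD8 P = Σ (D8 → Carrier) λ φ → ( (∀ a b → φ (a *D8 b) ≈ φ a ∙ φ b)
                   × (∀ a b → φ a ≈ φ b → a ≡ b)
                   × (∀ x → P x → ∃[ a ] (x ≈ φ a))
                   × (∀ a → P (φ a)))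

{-# OPTIONS --safe #-}
-- Transporting identities of D₈ along the embedding, and using that conjugation by h permutes
-- v, w², w²v cyclically (v = 1 would force u² = w² = 1, leaving no room for D₈), one finds that
-- u, v, w² are involutions, w² is central in ⟨u,v⟩ and vᵘ = w²v. Hence ⟨h,u⟩ normalises
-- V = {1, w², v, w²v} and M = V⟨h,u⟩ is a subgroup.
-- For t ∈ {v, w²}: (th)ᵘ(th) = tᵘtʰ = v and v^(th) = vʰ = w², so V ≤ ⟨th,u⟩, then h ∈ ⟨th,u⟩,
-- and ⟨th,u⟩ = M. For t = 1 and t = w²v, conjugation by 1 resp. w² sends th to h and fixes u
-- and v, so ⟨th,u⟩ = M would put v into ⟨h,u⟩ ≤ K, contradicting N ∩ K = 1.
module Submission where

open import Defs
open import Level using (0ℓ)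
open import Algebra.Bundles using (Group)
open import Data.Bool.Base using (Bool; true; false; _xor_)
open import Data.Bool.Properties as Bool using (xor-same)
open import Data.Empty using (⊥-elim)
open import Data.Nat using (ℕ)
open import Data.Nat.Coprimality using (Coprime)
open import Data.Fin.Base using (zero; suc)
import Data.Fin.Properties as Fin
open import Data.Product using (_×_; _,_; proj₁; proj₂; ∃-syntax)
open import Data.Sum using (_⊎_; inj₁; inj₂)
open import Relation.Binary.Definitions using (DecidableEquality)
open import Relation.Binary.PropositionalEquality as ≡ using (_≡_; _≢_)
open import Relation.Nullary using (¬_)
open import Relation.Nullary.Decidable using (Dec; map′; from-yes; _×-dec_; _→-dec_; ¬?)
open import Relation.Unary using (Pred; Decidable)

module Dihedral where
  infixl 7 _*_
  _*_ : D8 → D8 → D8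
  _*_ = _*D8_

  e : D8
  e = d8 zero false

  infix 4 _≟_
  _≟_ : DecidableEquality D8
  d8 r s ≟ d8 r′ s′ =
    map′ (λ (p , q) → ≡.cong₂ d8 p q) (λ { ≡.refl → ≡.refl , ≡.refl }) (r Fin.≟ r′ ×-dec s Bool.≟ s′)

  all? : ∀ {p} {P : Pred D8 p} → Decidable P → Dec (∀ d → P d)
  all? P? = map′ (λ f → λ { (d8 r false) → proj₁ (f r) ; (d8 r true) → proj₂ (f r) })
                 (λ f r → f (d8 r false) , f (d8 r true))
                 (Fin.all? λ r → P? (d8 r false) ×-dec P? (d8 r true))

  x²y≡yx² : ∀ x y → x * x * y ≡ y * (x * x)
  x²y≡yx² = from-yes (all? λ x → all? λ y → x * x * y ≟ y * (x * x))

  x²x²≡e : ∀ x → x * x * (x * x) ≡ e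
  x²x²≡e = from-yes (all? λ x → x * x * (x * x) ≟ e)

  -- ab has order 4, so (ab)² is the central rotation; b ≠ (ab)² is then a reflection,
  -- and so is a = (ab)b.
  [ab]²≢e⇒a²≡e : ∀ a b → b ≢ e → b * b ≡ e →
                 (a * b) * (a * b) ≢ e → (a * b) * (a * b) * b ≢ e → a * a ≡ e
  [ab]²≢e⇒a²≡e = from-yes (all? λ a → all? λ b →
    ¬? (b ≟ e) →-dec b * b ≟ e →-dec ¬? ((a * b) * (a * b) ≟ e) →-dec ¬? ((a * b) * (a * b) * b ≟ e) →-dec
    a * a ≟ e)

module GroupLemmas (G : Group 0ℓ 0ℓ) where
  open GroupDefs G
  open import Algebra.Properties.Group G
  open import Algebra.Properties.Monoid monoid using (cancelˡ; cancelʳ; insertˡ; ε-comm)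
  open import Algebra.Solver.Monoid monoid using (solve; _⊜_; _⊕_)
  open import Relation.Binary.Reasoning.Setoid setoid

  idempotent⇒ε : ∀ {x} → x ∙ x ≈ x → x ≈ ε
  idempotent⇒ε {x} xx≈x = begin
    x                ≈⟨ insertˡ (inverseˡ x) x ⟩
    x ⁻¹ ∙ (x ∙ x)   ≈⟨ ∙-congˡ xx≈x ⟩
    x ⁻¹ ∙ x         ≈⟨ inverseˡ x ⟩
    ε                ∎

  involution⇒⁻¹≈ : ∀ {x} → x ∙ x ≈ ε → x ⁻¹ ≈ x
  involution⇒⁻¹≈ {x} xx≈ε = sym (inverseʳ-unique x x xx≈ε)

  conj-cong : ∀ {x y} b → x ≈ y → conj x b ≈ conj y b
  conj-cong b x≈y = ∙-congʳ (∙-congˡ x≈y)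

  conj-congʳ : ∀ x {b c} → b ≈ c → conj x b ≈ conj x c
  conj-congʳ x b≈c = ∙-cong (∙-congʳ (⁻¹-cong b≈c)) b≈c

  conj-homo-∙ : ∀ x y b → conj (x ∙ y) b ≈ conj x b ∙ conj y b
  conj-homo-∙ x y b = begin
    (b ⁻¹ ∙ (x ∙ y)) ∙ b                  ≈⟨ solve 4 (λ b′ x y b → (b′ ⊕ (x ⊕ y)) ⊕ b ⊜ (b′ ⊕ x) ⊕ (y ⊕ b)) refl (b ⁻¹) x y b ⟩
    (b ⁻¹ ∙ x) ∙ (y ∙ b)                  ≈⟨ ∙-congˡ (insertˡ (inverseʳ b) (y ∙ b)) ⟩
    (b ⁻¹ ∙ x) ∙ (b ∙ (b ⁻¹ ∙ (y ∙ b)))   ≈⟨ solve 4 (λ b′ x y b → (b′ ⊕ x) ⊕ (b ⊕ (b′ ⊕ (y ⊕ b))) ⊜ ((b′ ⊕ x) ⊕ b) ⊕ ((b′ ⊕ y) ⊕ b)) refl (b ⁻¹) x y b ⟩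
    conj x b ∙ conj y b                   ∎

  conj-ε : ∀ b → conj ε b ≈ ε
  conj-ε b = trans (∙-congʳ (identityʳ (b ⁻¹))) (inverseˡ b)

  conj-homo-⁻¹ : ∀ x b → conj (x ⁻¹) b ≈ conj x b ⁻¹
  conj-homo-⁻¹ x b = inverseʳ-unique (conj x b) (conj (x ⁻¹) b) (begin
    conj x b ∙ conj (x ⁻¹) b   ≈⟨ conj-homo-∙ x (x ⁻¹) b ⟨
    conj (x ∙ x ⁻¹) b          ≈⟨ conj-cong b (inverseʳ x) ⟩
    conj ε b                   ≈⟨ conj-ε b ⟩
    ε                          ∎)

  conj-identityʳ : ∀ x → conj x ε ≈ x
  conj-identityʳ x = trans (identityʳ _) (trans (∙-congʳ ε⁻¹≈ε) (identityˡ x))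

  conj-conj : ∀ x a b → conj (conj x a) b ≈ conj x (a ∙ b)
  conj-conj x a b = begin
    (b ⁻¹ ∙ ((a ⁻¹ ∙ x) ∙ a)) ∙ b   ≈⟨ solve 5 (λ b′ a′ x a b → (b′ ⊕ ((a′ ⊕ x) ⊕ a)) ⊕ b ⊜ ((b′ ⊕ a′) ⊕ x) ⊕ (a ⊕ b)) refl (b ⁻¹) (a ⁻¹) x a b ⟩
    ((b ⁻¹ ∙ a ⁻¹) ∙ x) ∙ (a ∙ b)   ≈⟨ ∙-congʳ (∙-congʳ (⁻¹-anti-homo-∙ a b)) ⟨
    conj x (a ∙ b)                  ∎

  conj-conj⁻¹ : ∀ x b → conj (conj x b) (b ⁻¹) ≈ x
  conj-conj⁻¹ x b = begin
    conj (conj x b) (b ⁻¹)   ≈⟨ conj-conj x b (b ⁻¹) ⟩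
    conj x (b ∙ b ⁻¹)        ≈⟨ conj-congʳ x (inverseʳ b) ⟩
    conj x ε                 ≈⟨ conj-identityʳ x ⟩
    x                        ∎

  conj⁻¹-inverse : ∀ {x y} b → conj x b ≈ y → conj y (b ⁻¹) ≈ x
  conj⁻¹-inverse {x} b xᵇ≈y = trans (conj-cong (b ⁻¹) (sym xᵇ≈y)) (conj-conj⁻¹ x b)

  conj≈⇒∙≈ : ∀ {x y b} → conj x b ≈ y → x ∙ b ≈ b ∙ y
  conj≈⇒∙≈ {x} {y} {b} xᵇ≈y = begin
    x ∙ b                  ≈⟨ insertˡ (inverseʳ b) (x ∙ b) ⟩
    b ∙ (b ⁻¹ ∙ (x ∙ b))   ≈⟨ ∙-congˡ (assoc (b ⁻¹) x b) ⟨
    b ∙ conj x b           ≈⟨ ∙-congˡ xᵇ≈y ⟩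
    b ∙ y                  ∎

  conj-injective : ∀ {x y} b → conj x b ≈ conj y b → x ≈ y
  conj-injective {y = y} b xᵇ≈yᵇ = trans (sym (conj⁻¹-inverse b xᵇ≈yᵇ)) (conj-conj⁻¹ y b)

  conj≈ε⇒≈ε : ∀ {x} b → conj x b ≈ ε → x ≈ ε
  conj≈ε⇒≈ε b p = conj-injective b (trans p (sym (conj-ε b)))

  comm⇒conj≈ : ∀ {x b} → x ∙ b ≈ b ∙ x → conj x b ≈ x
  comm⇒conj≈ {x} {b} xb≈bx = begin
    (b ⁻¹ ∙ x) ∙ b   ≈⟨ assoc _ _ _ ⟩
    b ⁻¹ ∙ (x ∙ b)   ≈⟨ ∙-congˡ xb≈bx ⟩
    b ⁻¹ ∙ (b ∙ x)   ≈⟨ cancelˡ (inverseˡ b) x ⟩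
    x                ∎

  conj-by-involution : ∀ x {b} → b ∙ b ≈ ε → conj x b ≈ (b ∙ x) ∙ b
  conj-by-involution x bb≈ε = ∙-congʳ (∙-congʳ (involution⇒⁻¹≈ bb≈ε))

  ⟨⟩-isSubgroup : ∀ {S} → IsSubgroup ⟨ S ⟩
  ⟨⟩-isSubgroup = one , mul , inv , resp

  ⟨⟩-least : ∀ {S P} → IsSubgroup P → S ⊆ P → ⟨ S ⟩ ⊆ P
  ⟨⟩-least P-sub S⊆P x (gen Sx) = S⊆P x Sx
  ⟨⟩-least (Pε , _ , _ , _) S⊆P _ one = Pε
  ⟨⟩-least P-sub@(_ , P∙ , _ , _) S⊆P _ (mul p q) = P∙ (⟨⟩-least P-sub S⊆P _ p) (⟨⟩-least P-sub S⊆P _ q)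
  ⟨⟩-least P-sub@(_ , _ , P⁻¹ , _) S⊆P _ (inv p) = P⁻¹ (⟨⟩-least P-sub S⊆P _ p)
  ⟨⟩-least P-sub@(_ , _ , _ , P≈) S⊆P _ (resp x≈y p) = P≈ x≈y (⟨⟩-least P-sub S⊆P _ p)

  ⟨,⟩₂-least : ∀ {a b P} → IsSubgroup P → P a → P b → ⟨ a , b ⟩₂ ⊆ P
  ⟨,⟩₂-least {P = P} P-sub@(_ , _ , _ , P≈) Pa Pb = ⟨⟩-least P-sub generators
    where
    generators : ∀ x → (x ≈ _) ⊎ (x ≈ _) → P x
    generators x (inj₁ x≈a) = P≈ (sym x≈a) Pa
    generators x (inj₂ x≈b) = P≈ (sym x≈b) Pb

  conj-preimage-isSubgroup : ∀ {P} b → IsSubgroup P → IsSubgroup (λ x → P (conj x b))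
  conj-preimage-isSubgroup b (Pε , P∙ , P⁻¹ , P≈) =
      P≈ (sym (conj-ε b)) Pε
    , (λ {x} {y} Px Py → P≈ (sym (conj-homo-∙ x y b)) (P∙ Px Py))
    , (λ {x} Px → P≈ (sym (conj-homo-⁻¹ x b)) (P⁻¹ Px))
    , (λ x≈y → P≈ (conj-cong b x≈y))

  subgroup-conj : ∀ {P x b} → IsSubgroup P → P x → P b → P (conj x b)
  subgroup-conj (_ , P∙ , P⁻¹ , _) Px Pb = P∙ (P∙ (P⁻¹ Pb) Px) Pb

  ·-isSubgroup : ∀ {P Q} → IsSubgroup P → IsSubgroup Q →
                 (∀ a b → P a → Q b → P (conj a b)) → IsSubgroup (P · Q)
  ·-isSubgroup {P} {Q} (Pε , P∙ , P⁻¹ , _) (Qε , Q∙ , Q⁻¹ , _) Q-normalises-P =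
      (ε , ε , Pε , Qε , sym (identityˡ ε))
    , ·-∙
    , ·-⁻¹
    , (λ { x≈y (a , b , Pa , Qb , x≈ab) → a , b , Pa , Qb , trans (sym x≈y) x≈ab })
    where
    ·-∙ : ∀ {x y} → (P · Q) x → (P · Q) y → (P · Q) (x ∙ y)
    ·-∙ {x} {y} (a , b , Pa , Qb , x≈ab) (a′ , b′ , Pa′ , Qb′ , y≈a′b′) =
      a ∙ conj a′ (b ⁻¹) , b ∙ b′ , P∙ Pa (Q-normalises-P a′ (b ⁻¹) Pa′ (Q⁻¹ Qb)) , Q∙ Qb Qb′ , (begin
        x ∙ y                                     ≈⟨ ∙-cong x≈ab y≈a′b′ ⟩
        (a ∙ b) ∙ (a′ ∙ b′)                       ≈⟨ ∙-congˡ (∙-congˡ (cancelˡ (inverseˡ b) b′)) ⟨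
        (a ∙ b) ∙ (a′ ∙ (b ⁻¹ ∙ (b ∙ b′)))        ≈⟨ solve 5 (λ a b a′ b′ c → (a ⊕ b) ⊕ (a′ ⊕ (c ⊕ (b ⊕ b′))) ⊜ (a ⊕ ((b ⊕ a′) ⊕ c)) ⊕ (b ⊕ b′)) refl a b a′ b′ (b ⁻¹) ⟩
        (a ∙ ((b ∙ a′) ∙ b ⁻¹)) ∙ (b ∙ b′)        ≈⟨ ∙-congʳ (∙-congˡ (∙-congʳ (∙-congʳ (⁻¹-involutive b)))) ⟨
        (a ∙ conj a′ (b ⁻¹)) ∙ (b ∙ b′)           ∎)
    ·-⁻¹ : ∀ {x} → (P · Q) x → (P · Q) (x ⁻¹)
    ·-⁻¹ {x} (a , b , Pa , Qb , x≈ab) =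
      conj (a ⁻¹) b , b ⁻¹ , Q-normalises-P (a ⁻¹) b (P⁻¹ Pa) Qb , Q⁻¹ Qb , (begin
        x ⁻¹                     ≈⟨ ⁻¹-cong x≈ab ⟩
        (a ∙ b) ⁻¹               ≈⟨ ⁻¹-anti-homo-∙ a b ⟩
        b ⁻¹ ∙ a ⁻¹              ≈⟨ cancelʳ (inverseʳ b) _ ⟨
        conj (a ⁻¹) b ∙ b ⁻¹     ∎)

  ⊆-·ʳ : ∀ {P Q} → Q ε → P ⊆ (P · Q)
  ⊆-·ʳ Qε x Px = x , ε , Px , Qε , sym (identityʳ x)

  ⊆-·ˡ : ∀ {P Q} → P ε → Q ⊆ (P · Q)
  ⊆-·ˡ Pε x Qx = ε , x , Pε , Qx , sym (identityˡ x)

  ⟨,⟩₂⊆⟨⟩₁·⟨⟩₁ : ∀ {a b} → (∀ x y → ⟨ a ⟩₁ x → ⟨ b ⟩₁ y → ⟨ a ⟩₁ (conj x y)) →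
                  ⟨ a , b ⟩₂ ⊆ (⟨ a ⟩₁ · ⟨ b ⟩₁)
  ⟨,⟩₂⊆⟨⟩₁·⟨⟩₁ {a} {b} ⟨b⟩-normalises-⟨a⟩ =
    ⟨,⟩₂-least (·-isSubgroup ⟨⟩-isSubgroup ⟨⟩-isSubgroup ⟨b⟩-normalises-⟨a⟩)
               (⊆-·ʳ one a (gen refl)) (⊆-·ˡ one b (gen refl))

  Normalises : Subset → Carrier → Set
  Normalises P b = ∀ a → P a → P (conj a b)

  Normaliser : Subset → Subset
  Normaliser P b = Normalises P b × Normalises P (b ⁻¹)

  module _ {P : Subset} (P-resp : ∀ {x y} → x ≈ y → P x → P y) where

    Normalises-resp : ∀ {b c} → b ≈ c → Normalises P b → Normalises P c
    Normalises-resp {b} b≈c b-normalises a Pa = P-resp (conj-congʳ a b≈c) (b-normalises a Pa)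

    Normalises-ε : Normalises P ε
    Normalises-ε a Pa = P-resp (sym (conj-identityʳ a)) Pa

    Normalises-∙ : ∀ {b c} → Normalises P b → Normalises P c → Normalises P (b ∙ c)
    Normalises-∙ {b} {c} b-normalises c-normalises a Pa =
      P-resp (conj-conj a b c) (c-normalises _ (b-normalises a Pa))

    Normaliser-isSubgroup : IsSubgroup (Normaliser P)
    Normaliser-isSubgroup =
        (Normalises-ε , Normalises-resp (sym ε⁻¹≈ε) Normalises-ε)
      , (λ {b} {c} (nb , nb⁻¹) (nc , nc⁻¹) →
           Normalises-∙ nb nc , Normalises-resp (sym (⁻¹-anti-homo-∙ b c)) (Normalises-∙ nc⁻¹ nb⁻¹))
      , (λ {b} (nb , nb⁻¹) → nb⁻¹ , Normalises-resp (sym (⁻¹-involutive b)) nb)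
      , (λ b≈c (nb , nb⁻¹) → Normalises-resp b≈c nb , Normalises-resp (⁻¹-cong b≈c) nb⁻¹)

  infixr 8 _^ᵇ_
  _^ᵇ_ : Carrier → Bool → Carrier
  x ^ᵇ false = ε
  x ^ᵇ true  = x

  ^ᵇ-xor : ∀ {x} → x ∙ x ≈ ε → ∀ i j → x ^ᵇ i ∙ x ^ᵇ j ≈ x ^ᵇ (i xor j)
  ^ᵇ-xor xx≈ε false j    = identityˡ _
  ^ᵇ-xor xx≈ε true false = identityʳ _
  ^ᵇ-xor xx≈ε true true  = xx≈ε

  ^ᵇ-comm : ∀ {x y} → x ∙ y ≈ y ∙ x → ∀ i j → x ^ᵇ i ∙ y ^ᵇ j ≈ y ^ᵇ j ∙ x ^ᵇ i
  ^ᵇ-comm xy≈yx false j    = sym (ε-comm _)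
  ^ᵇ-comm xy≈yx true false = ε-comm _
  ^ᵇ-comm xy≈yx true true  = xy≈yx

  ^ᵇ-ε : ∀ {x} → x ≈ ε → ∀ i → x ^ᵇ i ≈ ε
  ^ᵇ-ε x≈ε false = refl
  ^ᵇ-ε x≈ε true  = x≈ε

  Span₂ : Carrier → Carrier → Subset
  Span₂ x y z = ∃[ i ] ∃[ j ] z ≈ x ^ᵇ i ∙ y ^ᵇ j

  module _ {x y} (xx≈ε : x ∙ x ≈ ε) (yy≈ε : y ∙ y ≈ ε) (xy≈yx : x ∙ y ≈ y ∙ x) where

    Span₂-∙ : ∀ i j k l → (x ^ᵇ i ∙ y ^ᵇ j) ∙ (x ^ᵇ k ∙ y ^ᵇ l) ≈ x ^ᵇ (i xor k) ∙ y ^ᵇ (j xor l)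
    Span₂-∙ i j k l = begin
      (x ^ᵇ i ∙ y ^ᵇ j) ∙ (x ^ᵇ k ∙ y ^ᵇ l)   ≈⟨ solve 4 (λ a b c d → (a ⊕ b) ⊕ (c ⊕ d) ⊜ a ⊕ ((b ⊕ c) ⊕ d)) refl (x ^ᵇ i) (y ^ᵇ j) (x ^ᵇ k) (y ^ᵇ l) ⟩
      x ^ᵇ i ∙ ((y ^ᵇ j ∙ x ^ᵇ k) ∙ y ^ᵇ l)   ≈⟨ ∙-congˡ (∙-congʳ (^ᵇ-comm xy≈yx k j)) ⟨
      x ^ᵇ i ∙ ((x ^ᵇ k ∙ y ^ᵇ j) ∙ y ^ᵇ l)   ≈⟨ solve 4 (λ a b c d → a ⊕ ((b ⊕ c) ⊕ d) ⊜ (a ⊕ b) ⊕ (c ⊕ d)) refl (x ^ᵇ i) (x ^ᵇ k) (y ^ᵇ j) (y ^ᵇ l) ⟩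
      (x ^ᵇ i ∙ x ^ᵇ k) ∙ (y ^ᵇ j ∙ y ^ᵇ l)   ≈⟨ ∙-cong (^ᵇ-xor xx≈ε i k) (^ᵇ-xor yy≈ε j l) ⟩
      x ^ᵇ (i xor k) ∙ y ^ᵇ (j xor l)         ∎

    Span₂-isSubgroup : IsSubgroup (Span₂ x y)
    Span₂-isSubgroup =
        (false , false , sym (identityˡ ε))
      , (λ { (i , j , p) (k , l , q) → i xor k , j xor l , trans (∙-cong p q) (Span₂-∙ i j k l) })
      , (λ { (i , j , p) → i , j , trans (⁻¹-cong p) (involution⇒⁻¹≈ (square≈ε i j)) })
      , (λ { z≈z′ (i , j , p) → i , j , trans (sym z≈z′) p })
      where
      square≈ε : ∀ i j → (x ^ᵇ i ∙ y ^ᵇ j) ∙ (x ^ᵇ i ∙ y ^ᵇ j) ≈ ε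
      square≈ε i j = begin
        (x ^ᵇ i ∙ y ^ᵇ j) ∙ (x ^ᵇ i ∙ y ^ᵇ j)   ≈⟨ Span₂-∙ i j i j ⟩
        x ^ᵇ (i xor i) ∙ y ^ᵇ (j xor j)         ≡⟨ ≡.cong₂ (λ i′ j′ → x ^ᵇ i′ ∙ y ^ᵇ j′) (xor-same i) (xor-same j) ⟩
        ε ∙ ε                                   ≈⟨ identityˡ ε ⟩
        ε                                       ∎

    ⟨,⟩₂⊆Span₂ : ⟨ x , y ⟩₂ ⊆ Span₂ x y
    ⟨,⟩₂⊆Span₂ = ⟨,⟩₂-least Span₂-isSubgroup (true , false , sym (identityʳ x)) (false , true , sym (identityˡ y))

module D8Subgroup (G : Group 0ℓ 0ℓ) {P : GroupDefs.Subset G} (iso : GroupDefs.IsoD8 G P) where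
  open GroupDefs G
  open GroupLemmas G
  open Dihedral using (e; _*_; x²y≡yx²; x²x²≡e; [ab]²≢e⇒a²≡e)
  open import Relation.Binary.Reasoning.Setoid setoid

  private
    φ : D8 → Carrier
    φ = proj₁ iso

    φ-homo : ∀ a b → φ (a * b) ≈ φ a ∙ φ b
    φ-homo = proj₁ (proj₂ iso)

    φ-injective : ∀ a b → φ a ≈ φ b → a ≡ b
    φ-injective = proj₁ (proj₂ (proj₂ iso))

    φ-onto : ∀ x → P x → ∃[ a ] x ≈ φ a
    φ-onto = proj₁ (proj₂ (proj₂ (proj₂ iso)))

    φ-into : ∀ a → P (φ a)
    φ-into = proj₂ (proj₂ (proj₂ (proj₂ iso)))

    φ-identity : φ e ≈ ε
    φ-identity = idempotent⇒ε (sym (φ-homo e e))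

    ∙-φ : ∀ {x y a b} → x ≈ φ a → y ≈ φ b → x ∙ y ≈ φ (a * b)
    ∙-φ {a = a} {b} x≈φa y≈φb = trans (∙-cong x≈φa y≈φb) (sym (φ-homo a b))

    ≈ε⇒≡e : ∀ {x a} → x ≈ φ a → x ≈ ε → a ≡ e
    ≈ε⇒≡e {a = a} x≈φa x≈ε = φ-injective a e (trans (sym x≈φa) (trans x≈ε (sym φ-identity)))

    ≡e⇒≈ε : ∀ {x a} → x ≈ φ a → a ≡ e → x ≈ ε
    ≡e⇒≈ε x≈φa ≡.refl = trans x≈φa φ-identity

    ≉ε⇒≢e : ∀ {x a} → x ≈ φ a → ¬ x ≈ ε → a ≢ e
    ≉ε⇒≢e x≈φa x≉ε a≡e = x≉ε (≡e⇒≈ε x≈φa a≡e)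

  x²y≈yx² : ∀ {x y} → P x → P y → (x ∙ x) ∙ y ≈ y ∙ (x ∙ x)
  x²y≈yx² {x} {y} Px Py with φ-onto x Px | φ-onto y Py
  ... | a , x≈φa | b , y≈φb = begin
    (x ∙ x) ∙ y       ≈⟨ ∙-φ (∙-φ x≈φa x≈φa) y≈φb ⟩
    φ (a * a * b)     ≡⟨ ≡.cong φ (x²y≡yx² a b) ⟩
    φ (b * (a * a))   ≈⟨ ∙-φ y≈φb (∙-φ x≈φa x≈φa) ⟨
    y ∙ (x ∙ x)       ∎

  x²x²≈ε : ∀ {x} → P x → (x ∙ x) ∙ (x ∙ x) ≈ ε
  x²x²≈ε {x} Px with φ-onto x Px
  ... | a , x≈φa = ≡e⇒≈ε (∙-φ (∙-φ x≈φa x≈φa) (∙-φ x≈φa x≈φa)) (x²x²≡e a)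

  [xy]²≉ε⇒x²≈ε : ∀ {x y} → P x → P y → ¬ y ≈ ε → y ∙ y ≈ ε →
                 ¬ (x ∙ y) ∙ (x ∙ y) ≈ ε → ¬ ((x ∙ y) ∙ (x ∙ y)) ∙ y ≈ ε → x ∙ x ≈ ε
  [xy]²≉ε⇒x²≈ε {x} {y} Px Py y≉ε yy≈ε [xy]²≉ε [xy]²y≉ε with φ-onto x Px | φ-onto y Py
  ... | a , x≈φa | b , y≈φb = ≡e⇒≈ε (∙-φ x≈φa x≈φa) ([ab]²≢e⇒a²≡e a b
    (≉ε⇒≢e y≈φb y≉ε)
    (≈ε⇒≡e (∙-φ y≈φb y≈φb) yy≈ε)
    (≉ε⇒≢e (∙-φ xy≈φab xy≈φab) [xy]²≉ε)
    (≉ε⇒≢e (∙-φ (∙-φ xy≈φab xy≈φab) y≈φb) [xy]²y≉ε))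
    where
    xy≈φab : x ∙ y ≈ φ (a * b)
    xy≈φab = ∙-φ x≈φa y≈φb

  ⊈Span₂ : ∀ {x y} → y ≈ ε → ¬ P ⊆ Span₂ x y
  ⊈Span₂ {x} {y} y≈ε P⊆Span₂ = ρ≢ρ² (φ-injective ρ ρ² (trans (≈x ρ (λ ())) (sym (≈x ρ² (λ ())))))
    where
    ρ ρ² : D8
    ρ  = d8 (suc zero) false
    ρ² = d8 (suc (suc zero)) false

    ρ≢ρ² : ρ ≢ ρ²
    ρ≢ρ² ()

    ≈x : ∀ a → a ≢ e → φ a ≈ x
    ≈x a a≢e with P⊆Span₂ (φ a) (φ-into a)
    ... | false , j , φa≈y^j = ⊥-elim (a≢e (≈ε⇒≡e refl (trans φa≈y^j (trans (identityˡ _) (^ᵇ-ε y≈ε j)))))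
    ... | true  , j , φa≈xy^j = trans φa≈xy^j (trans (∙-congˡ (^ᵇ-ε y≈ε j)) (identityʳ x))

module Lemma7p4 (G : Group 0ℓ 0ℓ) (h u v : GroupDefs.Carrier G) where
  open GroupDefs G
  open GroupLemmas G
  open import Algebra.Properties.Monoid monoid using (cancelˡ; cancelʳ; elimˡ; ε-comm)
  open import Algebra.Solver.Monoid monoid using (solve; _⊜_; _⊕_)
  open import Relation.Binary.Reasoning.Setoid setoid

  w² : Carrier
  w² = (u ∙ v) ∙ (u ∙ v)

  V M : Subset
  V = ⟨ w² , v ⟩₂
  M = V · ⟨ h , u ⟩₂

  module Relations (iso : IsoD8 ⟨ u , v ⟩₂)
           (hw²v : conj (w² ∙ v) h ≈ v) (hv : conj v h ≈ w²) (hw² : conj w² h ≈ w² ∙ v) where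
    open D8Subgroup G iso

    private
      ⟨u,v⟩-u : ⟨ u , v ⟩₂ u
      ⟨u,v⟩-u = gen (inj₁ refl)

      ⟨u,v⟩-v : ⟨ u , v ⟩₂ v
      ⟨u,v⟩-v = gen (inj₂ refl)

      ⟨u,v⟩-uv : ⟨ u , v ⟩₂ (u ∙ v)
      ⟨u,v⟩-uv = mul ⟨u,v⟩-u ⟨u,v⟩-v

    ⟨u,v⟩⊆Span₂ : v ≈ ε → ⟨ u , v ⟩₂ ⊆ Span₂ u v
    ⟨u,v⟩⊆Span₂ v≈ε = ⟨,⟩₂⊆Span₂
      (begin
        u ∙ u              ≈⟨ ∙-cong (identityʳ u) (identityʳ u) ⟨
        (u ∙ ε) ∙ (u ∙ ε)  ≈⟨ ∙-cong (∙-congˡ v≈ε) (∙-congˡ v≈ε) ⟨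
        w²                 ≈⟨ hv ⟨
        conj v h           ≈⟨ conj-cong h v≈ε ⟩
        conj ε h           ≈⟨ conj-ε h ⟩
        ε                  ∎)
      (trans (∙-cong v≈ε v≈ε) (identityˡ ε))
      (trans (∙-congˡ v≈ε) (trans (ε-comm u) (∙-congʳ (sym v≈ε))))

    v≉ε : ¬ v ≈ ε
    v≉ε v≈ε = ⊈Span₂ v≈ε (⟨u,v⟩⊆Span₂ v≈ε)

    w²≉ε : ¬ w² ≈ ε
    w²≉ε w²≈ε = v≉ε (conj≈ε⇒≈ε h (trans hv w²≈ε))

    w²v≉ε : ¬ w² ∙ v ≈ ε
    w²v≉ε w²v≈ε = w²≉ε (conj≈ε⇒≈ε h (trans hw² w²v≈ε))

    w²w²≈ε : w² ∙ w² ≈ ε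
    w²w²≈ε = x²x²≈ε ⟨u,v⟩-uv

    w²v≈vw² : w² ∙ v ≈ v ∙ w²
    w²v≈vw² = x²y≈yx² ⟨u,v⟩-uv ⟨u,v⟩-v

    w²u≈uw² : w² ∙ u ≈ u ∙ w²
    w²u≈uw² = x²y≈yx² ⟨u,v⟩-uv ⟨u,v⟩-u

    vv≈ε : v ∙ v ≈ ε
    vv≈ε = conj≈ε⇒≈ε h (begin
      conj (v ∙ v) h         ≈⟨ conj-homo-∙ v v h ⟩
      conj v h ∙ conj v h    ≈⟨ ∙-cong hv hv ⟩
      w² ∙ w²                ≈⟨ w²w²≈ε ⟩
      ε                      ∎)

    uu≈ε : u ∙ u ≈ ε
    uu≈ε = [xy]²≉ε⇒x²≈ε ⟨u,v⟩-u ⟨u,v⟩-v v≉ε vv≈ε w²≉ε w²v≉ε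

    uvu≈w²v : (u ∙ v) ∙ u ≈ w² ∙ v
    uvu≈w²v = begin
      (u ∙ v) ∙ u                  ≈⟨ cancelʳ vv≈ε _ ⟨
      (((u ∙ v) ∙ u) ∙ v) ∙ v      ≈⟨ ∙-congʳ (assoc (u ∙ v) u v) ⟩
      w² ∙ v                       ∎

    module Generation (hu : conj h u ≈ h ⁻¹) (v∉⟨h,u⟩ : ¬ ⟨ h , u ⟩₂ v) where

      V-w² : V w²
      V-w² = gen (inj₁ refl)

      V-v : V v
      V-v = gen (inj₂ refl)

      V-w²v : V (w² ∙ v)
      V-w²v = mul V-w² V-v

      w²ᵘ≈w² : conj w² u ≈ w²
      w²ᵘ≈w² = comm⇒conj≈ w²u≈uw²

      vᵘ≈w²v : conj v u ≈ w² ∙ v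
      vᵘ≈w²v = trans (conj-by-involution v uu≈ε) uvu≈w²v

      normalises-V : ∀ {b} → V (conj w² b) → V (conj v b) → Normalises V b
      normalises-V = ⟨,⟩₂-least (conj-preimage-isSubgroup _ ⟨⟩-isSubgroup)

      ⟨h,u⟩⊆Normaliser : ⟨ h , u ⟩₂ ⊆ Normaliser V
      ⟨h,u⟩⊆Normaliser = ⟨,⟩₂-least (Normaliser-isSubgroup resp)
        ( normalises-V (resp (sym hw²) V-w²v) (resp (sym hv) V-w²)
        , normalises-V (resp (sym (conj⁻¹-inverse h hv)) V-v) (resp (sym (conj⁻¹-inverse h hw²v)) V-w²v))
        ( u-normalises
        , Normalises-resp resp (sym (involution⇒⁻¹≈ uu≈ε)) u-normalises)
        where
        u-normalises : Normalises V u
        u-normalises = normalises-V (resp (sym w²ᵘ≈w²) V-w²) (resp (sym vᵘ≈w²v) V-w²v)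

      M-isSubgroup : IsSubgroup M
      M-isSubgroup = ·-isSubgroup ⟨⟩-isSubgroup ⟨⟩-isSubgroup
        (λ a b Va ⟨h,u⟩-b → proj₁ (⟨h,u⟩⊆Normaliser b ⟨h,u⟩-b) a Va)

      M-v : M v
      M-v = ⊆-·ʳ one v V-v

      uhu≈h⁻¹ : (u ∙ h) ∙ u ≈ h ⁻¹
      uhu≈h⁻¹ = trans (sym (conj-by-involution h uu≈ε)) hu

      [thᵘ]th≈tᵘtʰ : ∀ t → ((u ∙ (t ∙ h)) ∙ u) ∙ (t ∙ h) ≈ conj t u ∙ conj t h
      [thᵘ]th≈tᵘtʰ t = begin
        ((u ∙ (t ∙ h)) ∙ u) ∙ (t ∙ h)              ≈⟨ solve 3 (λ u t h → ((u ⊕ (t ⊕ h)) ⊕ u) ⊕ (t ⊕ h) ⊜ (u ⊕ t) ⊕ (h ⊕ (u ⊕ (t ⊕ h)))) refl u t h ⟩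
        (u ∙ t) ∙ (h ∙ (u ∙ (t ∙ h)))              ≈⟨ ∙-congˡ (elimˡ uu≈ε _) ⟨
        (u ∙ t) ∙ ((u ∙ u) ∙ (h ∙ (u ∙ (t ∙ h))))  ≈⟨ solve 3 (λ u t h → (u ⊕ t) ⊕ ((u ⊕ u) ⊕ (h ⊕ (u ⊕ (t ⊕ h)))) ⊜ ((u ⊕ t) ⊕ u) ⊕ ((((u ⊕ h) ⊕ u) ⊕ t) ⊕ h)) refl u t h ⟩
        ((u ∙ t) ∙ u) ∙ ((((u ∙ h) ∙ u) ∙ t) ∙ h)  ≈⟨ ∙-cong (conj-by-involution t uu≈ε) (∙-congʳ (∙-congʳ (sym uhu≈h⁻¹))) ⟨
        conj t u ∙ conj t h                        ∎

      ⟨th,u⟩≐M : ∀ {t} → V t → conj v t ≈ v → conj t u ∙ conj t h ≈ v → ⟨ t ∙ h , u ⟩₂ ≐ M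
      ⟨th,u⟩≐M {t} Vt vᵗ≈v tᵘtʰ≈v = ⟨th,u⟩⊆M , M⊆⟨th,u⟩
        where
        L : Subset
        L = ⟨ t ∙ h , u ⟩₂

        L-th : L (t ∙ h)
        L-th = gen (inj₁ refl)

        L-u : L u
        L-u = gen (inj₂ refl)

        L-v : L v
        L-v = resp (trans ([thᵘ]th≈tᵘtʰ t) tᵘtʰ≈v) (mul (mul (mul L-u L-th) L-u) L-th)

        L-w² : L w²
        L-w² = resp (trans (sym (conj-conj v t h)) (trans (conj-cong h vᵗ≈v) hv))
                    (subgroup-conj ⟨⟩-isSubgroup L-v L-th)

        V⊆L : V ⊆ L
        V⊆L = ⟨,⟩₂-least ⟨⟩-isSubgroup L-w² L-v

        L-h : L h
        L-h = resp (cancelˡ (inverseˡ t) h) (mul (inv (V⊆L t Vt)) L-th)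

        ⟨th,u⟩⊆M : L ⊆ M
        ⟨th,u⟩⊆M = ⟨,⟩₂-least M-isSubgroup (t , h , Vt , gen (inj₁ refl) , refl) (⊆-·ˡ one u (gen (inj₂ refl)))

        M⊆⟨th,u⟩ : M ⊆ L
        M⊆⟨th,u⟩ x (a , b , Va , ⟨h,u⟩-b , x≈ab) =
          resp (sym x≈ab) (mul (V⊆L a Va) (⟨,⟩₂-least ⟨⟩-isSubgroup L-h L-u b ⟨h,u⟩-b))

      t≈v⊎t≈w²⇒⟨th,u⟩≐M : ∀ {t} → (t ≈ v) ⊎ (t ≈ w²) → ⟨ t ∙ h , u ⟩₂ ≐ M
      t≈v⊎t≈w²⇒⟨th,u⟩≐M {t} (inj₁ t≈v) = ⟨th,u⟩≐M (resp (sym t≈v) V-v)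
        (comm⇒conj≈ (trans (∙-congˡ t≈v) (∙-congʳ (sym t≈v))))
        (begin
          conj t u ∙ conj t h   ≈⟨ ∙-cong (conj-cong u t≈v) (conj-cong h t≈v) ⟩
          conj v u ∙ conj v h   ≈⟨ ∙-cong vᵘ≈w²v hv ⟩
          (w² ∙ v) ∙ w²         ≈⟨ assoc w² v w² ⟩
          w² ∙ (v ∙ w²)         ≈⟨ ∙-congˡ w²v≈vw² ⟨
          w² ∙ (w² ∙ v)         ≈⟨ cancelˡ w²w²≈ε v ⟩
          v                     ∎)
      t≈v⊎t≈w²⇒⟨th,u⟩≐M {t} (inj₂ t≈w²) = ⟨th,u⟩≐M (resp (sym t≈w²) V-w²)
        (comm⇒conj≈ (trans (∙-congˡ t≈w²) (trans (sym w²v≈vw²) (∙-congʳ (sym t≈w²)))))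
        (begin
          conj t u ∙ conj t h   ≈⟨ ∙-cong (conj-cong u t≈w²) (conj-cong h t≈w²) ⟩
          conj w² u ∙ conj w² h ≈⟨ ∙-cong w²ᵘ≈w² hw² ⟩
          w² ∙ (w² ∙ v)         ≈⟨ cancelˡ w²w²≈ε v ⟩
          v                     ∎)

      v∉⟨th,u⟩ : ∀ {t} s → conj (t ∙ h) s ≈ h → conj u s ≈ u → conj v s ≈ v → ¬ ⟨ t ∙ h , u ⟩₂ v
      v∉⟨th,u⟩ s [th]ˢ≈h uˢ≈u vˢ≈v ⟨th,u⟩-v = v∉⟨h,u⟩ (resp vˢ≈v
        (⟨,⟩₂-least (conj-preimage-isSubgroup s ⟨⟩-isSubgroup)
                    (resp (sym [th]ˢ≈h) (gen (inj₁ refl))) (resp (sym uˢ≈u) (gen (inj₂ refl))) v ⟨th,u⟩-v))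

      ⟨th,u⟩≐M⇒t≈v⊎t≈w² : ∀ {t} → V t → ⟨ t ∙ h , u ⟩₂ ≐ M → (t ≈ v) ⊎ (t ≈ w²)
      ⟨th,u⟩≐M⇒t≈v⊎t≈w² {t} Vt (_ , M⊆⟨th,u⟩) with ⟨,⟩₂⊆Span₂ w²w²≈ε vv≈ε w²v≈vw² t Vt
      ... | false , true  , t≈εv  = inj₁ (trans t≈εv (identityˡ v))
      ... | true  , false , t≈w²ε = inj₂ (trans t≈w²ε (identityʳ w²))
      ... | false , false , t≈εε  =
        ⊥-elim (v∉⟨th,u⟩ ε [th]ᵋ≈h (conj-identityʳ u) (conj-identityʳ v) (M⊆⟨th,u⟩ v M-v))
        where
        [th]ᵋ≈h : conj (t ∙ h) ε ≈ h
        [th]ᵋ≈h = trans (conj-identityʳ (t ∙ h)) (elimˡ (trans t≈εε (identityˡ ε)) h)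
      ... | true  , true  , t≈w²v =
        ⊥-elim (v∉⟨th,u⟩ w² [th]ʷ²≈h (comm⇒conj≈ (sym w²u≈uw²)) (comm⇒conj≈ (sym w²v≈vw²)) (M⊆⟨th,u⟩ v M-v))
        where
        [th]ʷ²≈h : conj (t ∙ h) w² ≈ h
        [th]ʷ²≈h = begin
          conj (t ∙ h) w²                ≈⟨ conj-by-involution (t ∙ h) w²w²≈ε ⟩
          (w² ∙ (t ∙ h)) ∙ w²            ≈⟨ ∙-congʳ (∙-congˡ (∙-congʳ t≈w²v)) ⟩
          (w² ∙ ((w² ∙ v) ∙ h)) ∙ w²     ≈⟨ ∙-congʳ (solve 3 (λ a b c → a ⊕ ((a ⊕ b) ⊕ c) ⊜ (a ⊕ a) ⊕ (b ⊕ c)) refl w² v h) ⟩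
          ((w² ∙ w²) ∙ (v ∙ h)) ∙ w²     ≈⟨ ∙-congʳ (elimˡ w²w²≈ε (v ∙ h)) ⟩
          (v ∙ h) ∙ w²                   ≈⟨ ∙-congʳ (conj≈⇒∙≈ hv) ⟩
          (h ∙ w²) ∙ w²                  ≈⟨ cancelʳ w²w²≈ε h ⟩
          h                              ∎

lemma7p4 : (G : Group 0ℓ 0ℓ) → let open GroupDefs G in
  IsFinite →
  (g h c u v : Carrier) →
  let w = u ∙ v
      w² = w ∙ w
      V = ⟨ w² , v ⟩₂
      N = ⟨ g ⟩₁ · V
      HU = ⟨ h ⟩₁ · ⟨ u ⟩₁
      K = HU · ⟨ c ⟩₁
  in
  IsoD8 ⟨ u , v ⟩₂ →
  IsDirect ⟨ g ⟩₁ V →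
  IsSemidirect ⟨ h ⟩₁ ⟨ u ⟩₁ →
  IsDirect HU ⟨ c ⟩₁ →
  IsSemidirect N K →
  (∀ x → (N · K) x) →
  (og oh oc : ℕ) → HasOrder g og → HasOrder h oh → HasOrder c oc →
  Coprime og oh → Coprime og oc → Coprime oh oc →
  IsSylow 3 ⟨ h ⟩₁ →
  (∀ x → ⟨ c ⟩₁ x → x ∙ g ≈ g ∙ x → Φ ⟨ c ⟩₁ x) →
  conj (w² ∙ v) h ≈ v → conj v h ≈ w² → conj w² h ≈ w² ∙ v →
  conj h u ≈ h ⁻¹ →
  (t : Carrier) → V t →
  ((⟨ t ∙ h , u ⟩₂ ≐ (V · ⟨ h , u ⟩₂)) → (t ≈ v) ⊎ (t ≈ w²))
  × ((t ≈ v) ⊎ (t ≈ w²) → ⟨ t ∙ h , u ⟩₂ ≐ (V · ⟨ h , u ⟩₂))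
lemma7p4 G _ _ h _ u v iso _ sdHU _ (_ , N∩K≈ε) _ _ _ _ _ _ _ _ _ _ _ _ hw²v hv hw² hu t Vt =
  ⟨th,u⟩≐M⇒t≈v⊎t≈w² Vt , t≈v⊎t≈w²⇒⟨th,u⟩≐M
  where
  open GroupDefs G
  open GroupLemmas G
  open Lemma7p4 G h u v
  open Relations iso hw²v hv hw²

  v∉⟨h,u⟩ : ¬ ⟨ h , u ⟩₂ v
  v∉⟨h,u⟩ ⟨h,u⟩-v = v≉ε (N∩K≈ε v (⊆-·ˡ one v (gen (inj₂ refl)))
                                 (⊆-·ʳ one v (⟨,⟩₂⊆⟨⟩₁·⟨⟩₁ (proj₁ sdHU) v ⟨h,u⟩-v)))

  open Generation hu v∉⟨h,u⟩
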